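{- Let $C$ be the set of all $2$-element subsets of $Q_4=\{0,1,2,3\}$, and for $c\in C$ let $\overline{c}=Q_4\setminus c$. For a function $g:Q_4^n\to C$ let $F(g)=\{(a_1,\dots,a_n,a)\in Q_4^{n+1} : a\in g(a_1,\dots,a_n)\}$. Then $F(g)$ is a two-fold MDS code in $Q_4^{n+1}$ if and only if for every $c\in C$ and every one-dimensional face $L$ of $Q_4^n$, the number of points $x\in L$ with $g(x)=c$ equals the number of points $x\in L$ with $g(x)=\overline{c}$.
   Context: $Q_4^m$ is the set of words of length $m$ over $Q_4=\{0,1,2,3\}$. A one-dimensional face of direction $i$ through $(a_1,\dots,a_m)$ is $\{(a_1,\dots,a_{i-1},x,a_{i+1},\dots,a_m): x\in Q_4\}$. A set $W\subseteq Q_4^m$ is a $t$-fold MDS code if $|W\cap F|=t$ for every one-dimensional face $F$ of $Q_4^m$. -}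

module Defs where

open import Data.Nat using (ℕ; suc)
open import Data.Fin using (Fin)
open import Data.Fin.Subset using (Subset; ∁; _∈_; ∣_∣)
open import Data.Fin.Subset.Properties using (_∈?_)
open import Data.Vec using (Vec; _[_]≔_; init; last)
open import Data.List using (List; length; filter; map)
open import Data.List using () renaming (allFin to allFinL)
open import Data.Product using (Σ; proj₁)
open import Relation.Binary.PropositionalEquality using (_≡_)
open import Relation.Unary using (Pred; Decidable)
open import Level using (0ℓ)
open import Relation.Nullary using (Dec)
open import Data.Vec.Properties using (≡-dec)
import Data.Bool.Properties as Bool

Q₄ : Set
Q₄ = Fin 4

Word : ℕ → Set
Word m = Vec Q₄ m

face : ∀ {m} → Fin m → Word m → List (Word m)
face i a = map (λ x → a [ i ]≔ x) (allFinL 4)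

count : ∀ {A : Set} {P : Pred A 0ℓ} → Decidable P → List A → ℕ
count P? xs = length (filter P? xs)

IsMDS : ∀ {m} (t : ℕ) (W : Pred (Word m) 0ℓ) → Decidable W → Set
IsMDS {m} t W W? = ∀ (i : Fin m) (a : Word m) → count W? (face i a) ≡ t

C : Set
C = Σ (Subset 4) (λ c → ∣ c ∣ ≡ 2)

F : ∀ {n} → (Word n → C) → Pred (Word (suc n)) 0ℓ
F g v = last v ∈ proj₁ (g (init v))

F? : ∀ {n} (g : Word n → C) → Decidable (F g)
F? g v = last v ∈? proj₁ (g (init v))

-- g(x) = c, as equality of the underlying subsets of Q₄
-- (an element of C is determined by its underlying subset)
_≟ˢ_ : (s t : Subset 4) → Dec (s ≡ t)
_≟ˢ_ = ≡-dec Bool._≟_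

countVal : ∀ {n} → (Word n → C) → Subset 4 → List (Word n) → ℕ
countVal g c L = count (λ x → proj₁ (g x) ≟ˢ c) L

-- A face of Q₄ⁿ⁺¹ in the last direction through (a, y) meets F(g) in g(a), which has
-- two points.  A face in direction i ≤ n through (a, y) meets F(g) in the points x of
-- the face L of Q₄ⁿ through a in direction i with y ∈ g(x).  So F(g) is two-fold MDS
-- iff on every face L the four pairs g(x), x ∈ L, cover each point of Q₄ exactly
-- twice; for four 2-subsets of a 4-set this is equivalent to every pair occurring as
-- often as its complement, which is checked by evaluation over all 6⁴ quadruples.

module Submission where

open import Defs
open import Data.Nat using (ℕ; suc)
import Data.Nat as ℕ
open import Data.Fin using (Fin; zero; suc; fromℕ; inject₁)
open import Data.Fin.Properties using (all?)
open import Data.Fin.Relation.Unary.Top using (view; ‵fromℕ; ‵inject₁)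
open import Data.Fin.Subset using (Subset; ∁; ∣_∣; inside; outside)
open import Data.Fin.Subset.Properties using (_∈?_)
open import Data.Product using (_×_; _,_; proj₁; proj₂)
open import Data.List using (List; []; _∷_; map; tabulate; allFin)
open import Data.List.Properties using (map-tabulate)
open import Data.List.Relation.Unary.All as All using (All; []; _∷_)
open import Data.List.Membership.Propositional using () renaming (_∈_ to _∈ₗ_)
open import Data.List.Relation.Unary.Any using (here; there)
open import Data.Vec using (Vec; _∷ʳ_; _[_]≔_; initLast)
  renaming (_∷_ to _∷ᵥ_; [] to []ᵥ)
open import Data.Vec.Properties using (init-∷ʳ; last-∷ʳ)
open import Data.Bool using (true; false)
open import Function using (id; _∘_)
open import Function.Bundles using (_⇔_; mk⇔; module Equivalence)
open import Relation.Nullary using (does)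
open import Relation.Nullary.Decidable using (from-yes; _×-dec_; _→-dec_)
open import Relation.Unary using (Pred; Decidable)
open import Relation.Binary.PropositionalEquality
  using (_≡_; refl; sym; trans; cong; cong₂; module ≡-Reasoning)
open import Level using (0ℓ)

open Equivalence

private
  variable
    A B : Set
    P Q : Pred A 0ℓ

count-map : (P? : Decidable P) (f : B → A) (xs : List B) →
            count P? (map f xs) ≡ count (P? ∘ f) xs
count-map P? f [] = refl
count-map P? f (x ∷ xs) with does (P? (f x))
... | true  = cong suc (count-map P? f xs)
... | false = count-map P? f xs

count-cong : (P? : Decidable P) (Q? : Decidable Q) →
             (∀ x → does (P? x) ≡ does (Q? x)) → ∀ xs → count P? xs ≡ count Q? xs
count-cong P? Q? eq [] = refl
count-cong P? Q? eq (x ∷ xs) with does (P? x) | does (Q? x) | eq x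
... | true  | true  | refl = cong suc (count-cong P? Q? eq xs)
... | false | false | refl = count-cong P? Q? eq xs

count-∈-allFin : ∀ {n} (p : Subset n) → count (_∈? p) (allFin n) ≡ ∣ p ∣
count-∈-tabulate-suc : ∀ {n} b (p : Subset n) → count (_∈? b ∷ᵥ p) (tabulate suc) ≡ ∣ p ∣

count-∈-allFin []ᵥ            = refl
count-∈-allFin (inside  ∷ᵥ p) = cong suc (count-∈-tabulate-suc inside p)
count-∈-allFin (outside ∷ᵥ p) = count-∈-tabulate-suc outside p

count-∈-tabulate-suc {n} b p = begin
  count (_∈? b ∷ᵥ p) (tabulate suc)        ≡⟨ cong (count (_∈? b ∷ᵥ p)) (sym (map-tabulate id suc)) ⟩
  count (_∈? b ∷ᵥ p) (map suc (allFin n))  ≡⟨ count-map (_∈? b ∷ᵥ p) suc (allFin n) ⟩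
  count ((_∈? b ∷ᵥ p) ∘ suc) (allFin n)    ≡⟨ count-cong _ (_∈? p) (λ _ → refl) (allFin n) ⟩
  count (_∈? p) (allFin n)                 ≡⟨ count-∈-allFin p ⟩
  ∣ p ∣                                    ∎
  where open ≡-Reasoning

twoSubsets : List (Subset 4)
twoSubsets = (inside  ∷ᵥ inside  ∷ᵥ outside ∷ᵥ outside ∷ᵥ []ᵥ)
           ∷ (inside  ∷ᵥ outside ∷ᵥ inside  ∷ᵥ outside ∷ᵥ []ᵥ)
           ∷ (inside  ∷ᵥ outside ∷ᵥ outside ∷ᵥ inside  ∷ᵥ []ᵥ)
           ∷ (outside ∷ᵥ inside  ∷ᵥ inside  ∷ᵥ outside ∷ᵥ []ᵥ)
           ∷ (outside ∷ᵥ inside  ∷ᵥ outside ∷ᵥ inside  ∷ᵥ []ᵥ)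
           ∷ (outside ∷ᵥ outside ∷ᵥ inside  ∷ᵥ inside  ∷ᵥ []ᵥ)
           ∷ []

twoSubsets-size : All (λ s → ∣ s ∣ ≡ 2) twoSubsets
twoSubsets-size = refl ∷ refl ∷ refl ∷ refl ∷ refl ∷ refl ∷ []

∈-twoSubsets : (c : C) → proj₁ c ∈ₗ twoSubsets
∈-twoSubsets ((inside  ∷ᵥ inside  ∷ᵥ outside ∷ᵥ outside ∷ᵥ []ᵥ) , _) = here refl
∈-twoSubsets ((inside  ∷ᵥ outside ∷ᵥ inside  ∷ᵥ outside ∷ᵥ []ᵥ) , _) = there (here refl)
∈-twoSubsets ((inside  ∷ᵥ outside ∷ᵥ outside ∷ᵥ inside  ∷ᵥ []ᵥ) , _) = there (there (here refl))
∈-twoSubsets ((outside ∷ᵥ inside  ∷ᵥ inside  ∷ᵥ outside ∷ᵥ []ᵥ) , _) = there (there (there (here refl)))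
∈-twoSubsets ((outside ∷ᵥ inside  ∷ᵥ outside ∷ᵥ inside  ∷ᵥ []ᵥ) , _) = there (there (there (there (here refl))))
∈-twoSubsets ((outside ∷ᵥ outside ∷ᵥ inside  ∷ᵥ inside  ∷ᵥ []ᵥ) , _) = there (there (there (there (there (here refl)))))
∈-twoSubsets ((inside  ∷ᵥ inside  ∷ᵥ inside  ∷ᵥ inside  ∷ᵥ []ᵥ) , ())
∈-twoSubsets ((inside  ∷ᵥ inside  ∷ᵥ inside  ∷ᵥ outside ∷ᵥ []ᵥ) , ())
∈-twoSubsets ((inside  ∷ᵥ inside  ∷ᵥ outside ∷ᵥ inside  ∷ᵥ []ᵥ) , ())
∈-twoSubsets ((inside  ∷ᵥ outside ∷ᵥ inside  ∷ᵥ inside  ∷ᵥ []ᵥ) , ())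
∈-twoSubsets ((inside  ∷ᵥ outside ∷ᵥ outside ∷ᵥ outside ∷ᵥ []ᵥ) , ())
∈-twoSubsets ((outside ∷ᵥ inside  ∷ᵥ inside  ∷ᵥ inside  ∷ᵥ []ᵥ) , ())
∈-twoSubsets ((outside ∷ᵥ inside  ∷ᵥ outside ∷ᵥ outside ∷ᵥ []ᵥ) , ())
∈-twoSubsets ((outside ∷ᵥ outside ∷ᵥ inside  ∷ᵥ outside ∷ᵥ []ᵥ) , ())
∈-twoSubsets ((outside ∷ᵥ outside ∷ᵥ outside ∷ᵥ inside  ∷ᵥ []ᵥ) , ())
∈-twoSubsets ((outside ∷ᵥ outside ∷ᵥ outside ∷ᵥ outside ∷ᵥ []ᵥ) , ())

TwofoldCover : List (Subset 4) → Set
TwofoldCover ss = ∀ y → count (y ∈?_) ss ≡ 2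

ComplementBalancedOn : List (Subset 4) → List (Subset 4) → Set
ComplementBalancedOn cs ss = All (λ c → count (_≟ˢ c) ss ≡ count (_≟ˢ ∁ c) ss) cs

ComplementBalanced : List (Subset 4) → Set
ComplementBalanced ss = ∀ (c : C) → count (_≟ˢ proj₁ c) ss ≡ count (_≟ˢ ∁ (proj₁ c)) ss

twofoldCover? : Decidable TwofoldCover
twofoldCover? ss = all? (λ y → count (y ∈?_) ss ℕ.≟ 2)

complementBalancedOn? : ∀ cs → Decidable (ComplementBalancedOn cs)
complementBalancedOn? cs ss = All.all? (λ c → count (_≟ˢ c) ss ℕ.≟ count (_≟ˢ ∁ c) ss) cs

complementBalanced⇔balancedOnTwoSubsets : ∀ ss → ComplementBalanced ss ⇔ ComplementBalancedOn twoSubsets ss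
complementBalanced⇔balancedOnTwoSubsets ss = mk⇔
  (λ h → All.tabulate (λ {s} s∈ → h (s , All.lookup twoSubsets-size s∈)))
  (λ h c → All.lookup h (∈-twoSubsets c))

twofoldCover⇔balanced-exhaustive :
  All (λ s₁ → All (λ s₂ → All (λ s₃ → All (λ s₄ →
    let ss = s₁ ∷ s₂ ∷ s₃ ∷ s₄ ∷ [] in
    (TwofoldCover ss → ComplementBalancedOn twoSubsets ss) ×
    (ComplementBalancedOn twoSubsets ss → TwofoldCover ss))
  twoSubsets) twoSubsets) twoSubsets) twoSubsets
twofoldCover⇔balanced-exhaustive = from-yes
  (All.all? (λ s₁ → All.all? (λ s₂ → All.all? (λ s₃ → All.all? (λ s₄ →
    let ss = s₁ ∷ s₂ ∷ s₃ ∷ s₄ ∷ [] in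
    (twofoldCover? ss →-dec complementBalancedOn? twoSubsets ss) ×-dec
    (complementBalancedOn? twoSubsets ss →-dec twofoldCover? ss))
  twoSubsets) twoSubsets) twoSubsets) twoSubsets)

twofoldCover⇔complementBalanced : ∀ (s₁ s₂ s₃ s₄ : C) →
  let ss = proj₁ s₁ ∷ proj₁ s₂ ∷ proj₁ s₃ ∷ proj₁ s₄ ∷ [] in
  TwofoldCover ss ⇔ ComplementBalanced ss
twofoldCover⇔complementBalanced s₁ s₂ s₃ s₄ = mk⇔
  (λ cover → from balanced⇔ (proj₁ decided cover))
  (λ balanced → proj₂ decided (to balanced⇔ balanced))
  where
  ss : List (Subset 4)
  ss = proj₁ s₁ ∷ proj₁ s₂ ∷ proj₁ s₃ ∷ proj₁ s₄ ∷ []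
  balanced⇔ : ComplementBalanced ss ⇔ ComplementBalancedOn twoSubsets ss
  balanced⇔ = complementBalanced⇔balancedOnTwoSubsets ss
  decided : (TwofoldCover ss → ComplementBalancedOn twoSubsets ss) ×
            (ComplementBalancedOn twoSubsets ss → TwofoldCover ss)
  decided = All.lookup (All.lookup (All.lookup (All.lookup twofoldCover⇔balanced-exhaustive
    (∈-twoSubsets s₁)) (∈-twoSubsets s₂)) (∈-twoSubsets s₃)) (∈-twoSubsets s₄)

∷ʳ-[fromℕ]≔ : ∀ {n} (xs : Vec A n) (y x : A) → (xs ∷ʳ y) [ fromℕ n ]≔ x ≡ xs ∷ʳ x
∷ʳ-[fromℕ]≔ []ᵥ       y x = refl
∷ʳ-[fromℕ]≔ (z ∷ᵥ xs) y x = cong (z ∷ᵥ_) (∷ʳ-[fromℕ]≔ xs y x)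

∷ʳ-[inject₁]≔ : ∀ {n} (xs : Vec A n) (i : Fin n) (y x : A) →
                (xs ∷ʳ y) [ inject₁ i ]≔ x ≡ (xs [ i ]≔ x) ∷ʳ y
∷ʳ-[inject₁]≔ (z ∷ᵥ xs) zero    y x = refl
∷ʳ-[inject₁]≔ (z ∷ᵥ xs) (suc i) y x = cong (z ∷ᵥ_) (∷ʳ-[inject₁]≔ xs i y x)

module _ {n : ℕ} (g : Word n → C) where

  valuesOnFace : Fin n → Word n → List (Subset 4)
  valuesOnFace i a = map (λ x → proj₁ (g (a [ i ]≔ x))) (allFin 4)

  does-F-∷ʳ : ∀ (w : Word n) y → does (F? g (w ∷ʳ y)) ≡ does (y ∈? proj₁ (g w))
  does-F-∷ʳ w y = cong₂ (λ w y → does (y ∈? proj₁ (g w))) (init-∷ʳ y w) (last-∷ʳ y w)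

  count-F-face-fromℕ : ∀ a y → count (F? g) (face (fromℕ n) (a ∷ʳ y)) ≡ 2
  count-F-face-fromℕ a y = begin
    count (F? g) (face (fromℕ n) (a ∷ʳ y))                    ≡⟨ count-map (F? g) _ (allFin 4) ⟩
    count (λ x → F? g ((a ∷ʳ y) [ fromℕ n ]≔ x)) (allFin 4)  ≡⟨ count-cong _ (_∈? proj₁ (g a)) lastPoint (allFin 4) ⟩
    count (_∈? proj₁ (g a)) (allFin 4)                        ≡⟨ count-∈-allFin (proj₁ (g a)) ⟩
    ∣ proj₁ (g a) ∣                                           ≡⟨ proj₂ (g a) ⟩
    2                                                         ∎
    where
    open ≡-Reasoning
    lastPoint : ∀ x → does (F? g ((a ∷ʳ y) [ fromℕ n ]≔ x)) ≡ does (x ∈? proj₁ (g a))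
    lastPoint x = trans (cong (does ∘ F? g) (∷ʳ-[fromℕ]≔ a y x)) (does-F-∷ʳ a x)

  count-F-face-inject₁ : ∀ a i y →
    count (F? g) (face (inject₁ i) (a ∷ʳ y)) ≡ count (y ∈?_) (valuesOnFace i a)
  count-F-face-inject₁ a i y = begin
    count (F? g) (face (inject₁ i) (a ∷ʳ y))                       ≡⟨ count-map (F? g) _ (allFin 4) ⟩
    count (λ x → F? g ((a ∷ʳ y) [ inject₁ i ]≔ x)) (allFin 4)     ≡⟨ count-cong _ _ point (allFin 4) ⟩
    count (λ x → y ∈? proj₁ (g (a [ i ]≔ x))) (allFin 4)          ≡⟨ count-map (y ∈?_) _ (allFin 4) ⟨
    count (y ∈?_) (valuesOnFace i a)                               ∎
    where
    open ≡-Reasoning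
    point : ∀ x → does (F? g ((a ∷ʳ y) [ inject₁ i ]≔ x)) ≡ does (y ∈? proj₁ (g (a [ i ]≔ x)))
    point x = trans (cong (does ∘ F? g) (∷ʳ-[inject₁]≔ a i y x)) (does-F-∷ʳ (a [ i ]≔ x) y)

  isMDS⇔twofoldCoverOnFaces : IsMDS 2 (F g) (F? g) ⇔ (∀ i a → TwofoldCover (valuesOnFace i a))
  isMDS⇔twofoldCoverOnFaces = mk⇔
    (λ mds i a y → trans (sym (count-F-face-inject₁ a i y)) (mds (inject₁ i) (a ∷ʳ y)))
    covered⇒mds
    where
    covered⇒mds : (∀ i a → TwofoldCover (valuesOnFace i a)) → IsMDS 2 (F g) (F? g)
    covered⇒mds cover i v with initLast v
    ... | a , y , refl with view i
    ...   | ‵fromℕ     = count-F-face-fromℕ a y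
    ...   | ‵inject₁ j = trans (count-F-face-inject₁ a j y) (cover j a y)

  countVal-face : ∀ c i a → countVal g c (face i a) ≡ count (_≟ˢ c) (valuesOnFace i a)
  countVal-face c i a = trans (count-map (λ x → proj₁ (g x) ≟ˢ c) (a [ i ]≔_) (allFin 4))
    (sym (count-map (_≟ˢ c) (λ x → proj₁ (g (a [ i ]≔ x))) (allFin 4)))

  twofoldCover⇔balancedOnFace : ∀ i a →
    TwofoldCover (valuesOnFace i a) ⇔
    (∀ (c : C) → countVal g (proj₁ c) (face i a) ≡ countVal g (∁ (proj₁ c)) (face i a))
  twofoldCover⇔balancedOnFace i a = mk⇔
    (λ cover c → begin
      countVal g (proj₁ c) (face i a)           ≡⟨ countVal-face (proj₁ c) i a ⟩
      count (_≟ˢ proj₁ c) (valuesOnFace i a)     ≡⟨ to onFace cover c ⟩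
      count (_≟ˢ ∁ (proj₁ c)) (valuesOnFace i a) ≡⟨ countVal-face (∁ (proj₁ c)) i a ⟨
      countVal g (∁ (proj₁ c)) (face i a)       ∎)
    (λ balanced → from onFace λ c →
      trans (sym (countVal-face (proj₁ c) i a)) (trans (balanced c) (countVal-face (∁ (proj₁ c)) i a)))
    where
    open ≡-Reasoning
    onFace : TwofoldCover (valuesOnFace i a) ⇔ ComplementBalanced (valuesOnFace i a)
    onFace = twofoldCover⇔complementBalanced (g (a [ i ]≔ zero)) (g (a [ i ]≔ suc zero))
      (g (a [ i ]≔ suc (suc zero))) (g (a [ i ]≔ suc (suc (suc zero))))

proposition10 : ∀ (n : ℕ) (g : Word n → C) →
    IsMDS 2 (F g) (F? g)
      ⇔ (∀ (c : C) (i : Fin n) (a : Word n) →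
           countVal g (proj₁ c) (face i a) ≡ countVal g (∁ (proj₁ c)) (face i a))
proposition10 n g = mk⇔
  (λ mds c i a → to (twofoldCover⇔balancedOnFace g i a) (to (isMDS⇔twofoldCoverOnFaces g) mds i a) c)
  (λ balanced → from (isMDS⇔twofoldCoverOnFaces g)
    (λ i a → from (twofoldCover⇔balancedOnFace g i a) (λ c → balanced c i a)))
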